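{- For each of the following $n$ and subgroups $G \le S_n$, the union of the listed $\frac{(n-1)!}{|G|}$ distinct left cosets of $G$ (a set of $(n-1)!$ sequences) is a ${\rm PSCA}(n,n-1,1)$. (i) $n=4$, $G = \langle 3412 \rangle \cong C_2$: cosets $\pi G$ for $\pi \in \{1234, 1432, 2413\}$. (ii) $n=5$, $G = \langle 34125, 43215 \rangle \cong C_2 \times C_2$: cosets $\pi G$ for $\pi \in \{12345, 13254, 14253, 15243, 15342, 51432\}$. (iii) $n=6$, $G = \langle 125634, 346521, 345612 \rangle \cong S_4$: cosets $\pi G$ for $\pi \in \{123456, 132546, 132645, 135642, 136524\}$. (iv) $n=7$, $G = \langle 7235461, 1756432 \rangle \cong S_4$: cosets $\pi G$ for $\pi \in \{1234657, 1235476, 1237456, 1273564, 1324576, 1325467, 1326475, 1326574, 1342756, 1345267, 1352764, 1356427, 1357246, 3124756, 3125746, 3126745, 3127654, 3145627, 3154267, 3154762, 3156742, 3412657, 3415276, 3421567, 3425176, 3426715, 3427651, 3456172, 3457126, 3457621\}$.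
   Context: $S_n$ is the symmetric group on $[n]=\{1,\dots,n\}$, each permutation $x$ written as the sequence $x(1)x(2)\cdots x(n)$ of its values. Composition convention: $\pi\sigma$ means $\pi$ followed by $\sigma$, so the sequence of $\pi\sigma$ is $\sigma(\pi(1))\cdots\sigma(\pi(n))$; a left coset is $\pi G = \{\pi g : g \in G\}$, and $\langle \cdot \rangle$ denotes the subgroup generated. $S_{n,k}$ is the set of sequences of $k$ distinct elements of $[n]$; $x\in S_n$ covers $y \in S_{n,k}$ if $y$ is a (not necessarily contiguous) subsequence of $x$. A ${\rm PSCA}(n,k,\lambda)$ is a multiset $P$ of elements of $S_n$ such that every $y \in S_{n,k}$ is covered by exactly $\lambda$ elements of $P$, counted with multiplicity. -}

module Defs where

open import Data.Nat using (ℕ; zero; suc; _≤_; _∸_; _≤?_; _<_)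
open import Data.Nat.Properties using (≤-trans; ≤-refl)
open import Data.Fin using (Fin; fromℕ<)
open import Data.Vec using (Vec; []; _∷_; map; lookup; allFin; toList)
open import Data.Vec.Relation.Unary.All using (All; []; _∷_; all?)
open import Data.List using (List; length)
import Data.List as L
open import Data.List.Relation.Unary.Unique.Propositional using (Unique)
open import Data.List.Relation.Binary.Sublist.Propositional using (_⊆_)
open import Data.List.Membership.Propositional using (_∈_)
open import Data.Product using (Σ; ∃; ∃-syntax; _×_; _,_; proj₁; proj₂)
open import Relation.Nullary.Decidable using (True; toWitness; _×-dec_)
open import Relation.Binary.PropositionalEquality using (_≡_)

-- The ground set [n] = {1,…,n} is represented by Fin n (value k ↦ k-1).
-- A permutation x ∈ S_n is represented by its sequence x(1)…x(n).
Perm : ℕ → Set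
Perm n = Vec (Fin n) n

-- Composition: π · σ is "π followed by σ"; its sequence is σ(π(1))…σ(π(n)).
_·_ : ∀ {n} → Perm n → Perm n → Perm n
π · σ = map (lookup σ) π

idPerm : ∀ {n} → Perm n
idPerm = allFin _

data ⟨_⟩ {n : ℕ} (gens : List (Perm n)) : Perm n → Set where
  gen : ∀ {g} → g ∈ gens → ⟨ gens ⟩ g
  one : ⟨ gens ⟩ idPerm
  mul : ∀ {x y} → ⟨ gens ⟩ x → ⟨ gens ⟩ y → ⟨ gens ⟩ (x · y)
  inv : ∀ {x y} → ⟨ gens ⟩ x → x · y ≡ idPerm → ⟨ gens ⟩ y

record Seq (n k : ℕ) : Set where
  constructor mkSeq
  field
    elems    : List (Fin n)
    len      : length elems ≡ k
    distinct : Unique elems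

Covers : ∀ {n k} → Perm n → Seq n k → Set
Covers x y = Seq.elems y ⊆ toList x

-- The multiset union of the left cosets π G for π in a list of
-- representatives: an element of the multiset is a pair (i , x) with
-- i indexing a representative and x ∈ (reps ! i) ⟨ gens ⟩.
InCosetUnion : ∀ {n} (reps : List (Perm n)) (gens : List (Perm n))
             → Fin (length reps) → Perm n → Set
InCosetUnion reps gens i x = ∃[ g ] (⟨ gens ⟩ g × x ≡ L.lookup reps i · g)

IsPSCA₁CosetUnion : (n k : ℕ) (reps gens : List (Perm n)) → Set
IsPSCA₁CosetUnion n k reps gens =
  (y : Seq n k) →
    Σ (Fin (length reps) × Perm n) (λ { (i , x) →
        InCosetUnion reps gens i x × Covers x y
      × ((j : Fin (length reps)) (z : Perm n) →
           InCosetUnion reps gens j z → Covers z y → (i ≡ j × x ≡ z)) })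

-- Writing a permutation by its 1-based value sequence, e.g. perm (3 ∷ 4 ∷ 1 ∷ 2 ∷ []).
InRange : ℕ → ℕ → Set
InRange n k = 1 ≤ k × k ≤ n

private
  toFin : ∀ {n k} → InRange n k → Fin n
  toFin {suc n} {suc k} (_ , k≤n) = fromℕ< {k} {suc n} k≤n
  toFin {zero} {suc k} (_ , ())

  conv : ∀ {n m} (xs : Vec ℕ m) → All (InRange n) xs → Vec (Fin n) m
  conv [] [] = []
  conv (x ∷ xs) (p ∷ ps) = toFin p ∷ conv xs ps

perm : ∀ {n} (xs : Vec ℕ n)
       {ok : True (all? (λ k → (1 ≤? k) ×-dec (k ≤? _)) xs)} → Perm n
perm xs {ok} = conv xs (toWitness ok)

-- The proof is a certified finite computation.  The subgroup ⟨ gens ⟩ is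
-- enumerated by closing {1} under right multiplication by the generators;
-- the resulting list is shown to contain all of ⟨ gens ⟩ by checking that it
-- contains the generators and 1 and is closed under products and left
-- inverses (a left inverse x′ of x forces every right inverse of x to be x′).
-- The sequences y ∈ S_{n,k} are then enumerated as a prefix tree.  Along a
-- branch we keep only the coset elements that contain the prefix as a
-- subsequence, together with the part of their sequence after a greedy match
-- of the prefix; greedy matching is complete for subsequences, so exactly one
-- element must survive at every leaf.
module Submission where

open import Defs
open import Data.Product using (_×_)
open import Data.List using (List; []; _∷_)
open import Data.Vec using ([]; _∷_)

open import Data.Bool using (Bool; true; false; T; _∨_; if_then_else_)
open import Data.Bool.ListAction using (all)
open import Data.Bool.Properties using (T-∨)
open import Data.Fin using (Fin)
import Data.Fin.Properties as Fin
open import Data.List using ([_]; length; map; foldr; allFin; cartesianProduct; cartesianProductWith)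
import Data.List as List
open import Data.List.Membership.Propositional using (_∈_; _∉_; mapWith∈; find)
open import Data.List.Membership.Propositional.Properties
  using (∈-map⁺; ∈-map⁻; ∈-allFin; ∈-cartesianProduct⁺; ∈-cartesianProduct⁻)
import Data.List.Membership.DecPropositional as DecMembership
open import Data.List.Relation.Binary.Sublist.Propositional using (_⊆_; _∷_; _∷ʳ_; minimum)
open import Data.List.Relation.Binary.Sublist.Propositional.Properties using (∷ˡ⁻)
open import Data.List.Relation.Unary.All as All using (All; []; _∷_; all?)
open import Data.List.Relation.Unary.All.Properties using (all⁺)
open import Data.List.Relation.Unary.Any using (Any; here; there; any?)
open import Data.List.Relation.Unary.AllPairs using (_∷_)
open import Data.List.Relation.Unary.Unique.Propositional using (Unique)
open import Data.Maybe using (Maybe; just; nothing)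
open import Data.Maybe.Properties using (just-injective)
open import Data.Nat using (ℕ; zero; suc; _!; _≡ᵇ_)
open import Data.Nat.Properties using (suc-injective)
open import Data.Product using (Σ; ∃; _,_; proj₁; proj₂; map₁; map₂)
open import Data.Product.Properties using (,-injectiveˡ; ,-injectiveʳ)
open import Data.Sum using (inj₁; inj₂)
import Data.Vec as Vec
open import Data.Vec.Properties
  using (map-∘; map-cong; map-id; lookup-map; lookup-allFin; map-lookup-allFin; ≡-dec)
open import Function using (_∘_; case_of_; Equivalence)
open import Relation.Binary.Definitions using (DecidableEquality)
open import Relation.Binary.PropositionalEquality
  using (_≡_; _≢_; refl; sym; trans; cong; subst; module ≡-Reasoning)
open import Relation.Nullary using (yes; no; does; contradiction)
open import Relation.Nullary.Decidable using (True; _×-dec_; isYes; toWitness)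
open import Relation.Unary using (Decidable)

module _ {n : ℕ} where

  ·-assoc : (x y z : Perm n) → (x · y) · z ≡ x · (y · z)
  ·-assoc x y z = begin
    Vec.map (Vec.lookup z) (Vec.map (Vec.lookup y) x)
      ≡⟨ map-∘ (Vec.lookup z) (Vec.lookup y) x ⟨
    Vec.map (Vec.lookup z ∘ Vec.lookup y) x
      ≡⟨ map-cong (λ i → sym (lookup-map i (Vec.lookup z) y)) x ⟩
    Vec.map (Vec.lookup (y · z)) x
      ∎
    where open ≡-Reasoning

  ·-identityˡ : (x : Perm n) → idPerm · x ≡ x
  ·-identityˡ = map-lookup-allFin

  ·-identityʳ : (x : Perm n) → x · idPerm ≡ x
  ·-identityʳ x = trans (map-cong lookup-allFin x) (map-id x)

  inverseʳ≡inverseˡ : ∀ {x x′ y : Perm n} → x′ · x ≡ idPerm → x · y ≡ idPerm → y ≡ x′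
  inverseʳ≡inverseˡ {x} {x′} {y} x′x≡1 xy≡1 = begin
    y               ≡⟨ ·-identityˡ y ⟨
    idPerm · y      ≡⟨ cong (_· y) x′x≡1 ⟨
    (x′ · x) · y    ≡⟨ ·-assoc x′ x y ⟩
    x′ · (x · y)    ≡⟨ cong (x′ ·_) xy≡1 ⟩
    x′ · idPerm     ≡⟨ ·-identityʳ x′ ⟩
    x′              ∎
    where open ≡-Reasoning

_≟ₚ_ : ∀ {n} → DecidableEquality (Perm n)
_≟ₚ_ = ≡-dec Fin._≟_

module Subgroup {n : ℕ} (gens : List (Perm n)) where

  open DecMembership (_≟ₚ_ {n}) using (_∈?_)

  IsClosed : List (Perm n) → Set
  IsClosed G = All (_∈ G) gens
             × idPerm ∈ G
             × All (λ x → All (λ y → x · y ∈ G) G) G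
             × All (λ x → Any (λ x′ → x′ · x ≡ idPerm) G) G

  isClosed? : Decidable IsClosed
  isClosed? G = all? (_∈? G) gens
           ×-dec idPerm ∈? G
           ×-dec all? (λ x → all? (λ y → x · y ∈? G) G) G
           ×-dec all? (λ x → any? (λ x′ → (x′ · x) ≟ₚ idPerm) G) G

  ⟨⟩⊆closed : ∀ {G} → IsClosed G → ∀ {g} → ⟨ gens ⟩ g → g ∈ G
  ⟨⟩⊆closed (gens⊆G , _ , _ , _) (gen g∈gens) = All.lookup gens⊆G g∈gens
  ⟨⟩⊆closed (_ , 1∈G , _ , _) one = 1∈G
  ⟨⟩⊆closed G-closed@(_ , _ , mul-closed , _) (mul x∈ y∈) =
    All.lookup (All.lookup mul-closed (⟨⟩⊆closed G-closed x∈)) (⟨⟩⊆closed G-closed y∈)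
  ⟨⟩⊆closed G-closed@(_ , _ , _ , inv-closed) (inv x∈ xy≡1)
    with x′ , x′∈G , x′x≡1 ← find (All.lookup inv-closed (⟨⟩⊆closed G-closed x∈)) =
    subst (_∈ _) (sym (inverseʳ≡inverseˡ x′x≡1 xy≡1)) x′∈G

  Element : Set
  Element = Σ (Perm n) ⟨ gens ⟩

  generators : List Element
  generators = mapWith∈ gens (λ g∈gens → _ , gen g∈gens)

  insert : Element → List Element → List Element
  insert e es = if does (proj₁ e ∈? map proj₁ es) then es else e ∷ es

  grow : List Element → List Element
  grow es = foldr insert es (cartesianProductWith _*_ es generators)
    where
    _*_ : Element → Element → Element
    (x , x∈) * (g , g∈) = x · g , mul x∈ g∈

  -- Each round either stops or adds an element, so n ! rounds suffice; the
  -- result is in any case only trusted after the isClosed? check.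
  saturate : ℕ → List Element → List Element
  saturate zero es = es
  saturate (suc fuel) es = continue (grow es)
    where
    continue : List Element → List Element
    continue es′ = if length es′ ≡ᵇ length es then es else saturate fuel es′

  enumeration : List (Perm n)
  enumeration = map proj₁ (saturate (n !) [ idPerm , one ])

  enumeration⊆⟨⟩ : ∀ {g} → g ∈ enumeration → ⟨ gens ⟩ g
  enumeration⊆⟨⟩ g∈ with e , _ , refl ← ∈-map⁻ proj₁ g∈ = proj₂ e

module Coverage {X : Set} (_≟_ : DecidableEquality X) {A : Set} where

  open DecMembership _≟_ using (_∈?_)

  suffixAfter : X → List X → Maybe (List X)
  suffixAfter a [] = nothing
  suffixAfter a (b ∷ l) with a ≟ b
  ... | yes _ = just l
  ... | no _ = suffixAfter a l

  suffixAfter⇒∷⊆ : ∀ {a s ys} l → suffixAfter a l ≡ just s → ys ⊆ s → a ∷ ys ⊆ l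
  suffixAfter⇒∷⊆ {a} (b ∷ l) eq ys⊆s with a ≟ b | eq
  ... | yes refl | refl = refl ∷ ys⊆s
  ... | no _     | eq′  = b ∷ʳ suffixAfter⇒∷⊆ l eq′ ys⊆s

  ∷⊆⇒suffixAfter : ∀ {a ys} l → a ∷ ys ⊆ l → ∃ λ s → suffixAfter a l ≡ just s × ys ⊆ s
  ∷⊆⇒suffixAfter {a} (b ∷ l) a∷ys⊆b∷l with a ≟ b | a∷ys⊆b∷l
  ... | yes refl | refl ∷ ys⊆l = l , refl , ys⊆l
  ... | yes refl | .b ∷ʳ a∷ys⊆l = l , refl , ∷ˡ⁻ a∷ys⊆l
  ... | no a≢b   | refl ∷ _ = contradiction refl a≢b
  ... | no _     | .b ∷ʳ a∷ys⊆l = ∷⊆⇒suffixAfter l a∷ys⊆l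

  -- A candidate is a tag together with the part of its sequence that is still
  -- available for matching the rest of the sequence being covered.
  Candidates : Set
  Candidates = List (A × List X)

  restrict : X → Candidates → Candidates
  restrict a [] = []
  restrict a ((t , l) ∷ cs) with suffixAfter a l
  ... | nothing = restrict a cs
  ... | just s = (t , s) ∷ restrict a cs

  ∈-restrict⁻ : ∀ {a t s} cs → (t , s) ∈ restrict a cs →
                ∃ λ l → (t , l) ∈ cs × suffixAfter a l ≡ just s
  ∈-restrict⁻ {a} ((t , l) ∷ cs) ts∈ with suffixAfter a l in eq | ts∈
  ... | nothing | ts∈′       = map₂ (map₁ there) (∈-restrict⁻ cs ts∈′)
  ... | just s  | here refl  = l , here refl , eq
  ... | just s  | there ts∈′ = map₂ (map₁ there) (∈-restrict⁻ cs ts∈′)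

  ∈-restrict⁺ : ∀ {a t l s} cs → (t , l) ∈ cs → suffixAfter a l ≡ just s →
                (t , s) ∈ restrict a cs
  ∈-restrict⁺ {a} ((t′ , l′) ∷ cs) tl∈ eq with suffixAfter a l′ in eq′ | tl∈
  ... | nothing | here refl = case (trans (sym eq′) eq) of λ ()
  ... | nothing | there tl∈′ = ∈-restrict⁺ cs tl∈′ eq
  ... | just s′ | here refl = here (cong (t′ ,_) (just-injective (trans (sym eq) eq′)))
  ... | just s′ | there tl∈′ = there (∈-restrict⁺ cs tl∈′ eq)

  UniquelyCovered : Candidates → List X → Set
  UniquelyCovered cs ys =
    ∃ λ t → (∃ λ l → (t , l) ∈ cs × ys ⊆ l) × (∀ {t′ l′} → (t′ , l′) ∈ cs → ys ⊆ l′ → t′ ≡ t)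

  uniquelyCovered-restrict : ∀ {a ys} cs →
                             UniquelyCovered (restrict a cs) ys → UniquelyCovered cs (a ∷ ys)
  uniquelyCovered-restrict cs (t , (s , ts∈ , ys⊆s) , unique)
    with l , tl∈ , eq ← ∈-restrict⁻ cs ts∈ =
    t , (l , tl∈ , suffixAfter⇒∷⊆ l eq ys⊆s) , unique′
    where
    unique′ : ∀ {t′ l′} → (t′ , l′) ∈ cs → _ ∷ _ ⊆ l′ → t′ ≡ t
    unique′ {l′ = l′} t′l′∈ a∷ys⊆l′ with s′ , eq′ , ys⊆s′ ← ∷⊆⇒suffixAfter l′ a∷ys⊆l′ =
      unique (∈-restrict⁺ cs t′l′∈ eq′) ys⊆s′

  isSingleton : Candidates → Bool
  isSingleton (_ ∷ []) = true
  isSingleton _ = false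

  uniquelyCovered-singleton : ∀ cs → T (isSingleton cs) → UniquelyCovered cs []
  uniquelyCovered-singleton ((t , l) ∷ []) _ =
    t , (l , here refl , minimum l) , λ { (here refl) _ → refl }

  module _ (universe : List X) where

    allUniquelyCovered? : ℕ → List X → Candidates → Bool
    allUniquelyCovered? zero used cs = isSingleton cs
    allUniquelyCovered? (suc k) used cs =
      all (λ a → isYes (a ∈? used) ∨ allUniquelyCovered? k (a ∷ used) (restrict a cs)) universe

    allUniquelyCovered?-sound : (∀ x → x ∈ universe) →
      ∀ k used cs → T (allUniquelyCovered? k used cs) →
      ∀ ys → length ys ≡ k → Unique ys → All (_∉ used) ys → UniquelyCovered cs ys
    allUniquelyCovered?-sound complete zero used cs ok [] refl _ _ = uniquelyCovered-singleton cs ok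
    allUniquelyCovered?-sound complete (suc k) used cs ok
                              (a ∷ ys) len (a≢ys ∷ ys-unique) (a∉used ∷ ys∉used)
      with Equivalence.to T-∨ (All.lookup (all⁺ _ universe ok) (complete a))
    ... | inj₁ a∈used = contradiction (toWitness {a? = a ∈? used} a∈used) a∉used
    ... | inj₂ ok′ = uniquelyCovered-restrict cs
          (allUniquelyCovered?-sound complete k (a ∷ used) (restrict a cs) ok′
             ys (suc-injective len) ys-unique
             (All.zipWith (λ (a≢b , b∉used) → ∉-∷ a≢b b∉used) (a≢ys , ys∉used)))
      where
      ∉-∷ : ∀ {b} → a ≢ b → b ∉ used → b ∉ a ∷ used
      ∉-∷ a≢b _ (here refl) = a≢b refl
      ∉-∷ _ b∉used (there b∈used) = b∉used b∈used

cosetCandidate : ∀ {n} (reps : List (Perm n)) →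
                 Fin (length reps) × Perm n → (Fin (length reps) × Perm n) × List (Fin n)
cosetCandidate reps (i , g) = (i , List.lookup reps i · g) , Vec.toList (List.lookup reps i · g)

cosetCandidates : ∀ {n} (reps G : List (Perm n)) → List ((Fin (length reps) × Perm n) × List (Fin n))
cosetCandidates reps G = map (cosetCandidate reps) (cartesianProduct (allFin (length reps)) G)

∈-cosetCandidates⁺ : ∀ {n} (reps : List (Perm n)) {G g} (i : Fin (length reps)) →
                     g ∈ G → cosetCandidate reps (i , g) ∈ cosetCandidates reps G
∈-cosetCandidates⁺ reps i g∈G = ∈-map⁺ (cosetCandidate reps) (∈-cartesianProduct⁺ (∈-allFin i) g∈G)

∈-cosetCandidates⁻ : ∀ {n} (reps G : List (Perm n)) {c} → c ∈ cosetCandidates reps G →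
                     ∃ λ i → ∃ λ g → g ∈ G × c ≡ cosetCandidate reps (i , g)
∈-cosetCandidates⁻ reps G c∈
  with (i , g) , ig∈ , refl ← ∈-map⁻ (cosetCandidate reps) c∈ =
  i , g , proj₂ (∈-cartesianProduct⁻ (allFin (length reps)) G ig∈) , refl

cosetUnion-isPSCA₁ : ∀ {n} k (reps gens : List (Perm n)) →
  let open Subgroup gens in
  True (isClosed? enumeration) →
  T (Coverage.allUniquelyCovered? Fin._≟_ (allFin n) k [] (cosetCandidates reps enumeration)) →
  IsPSCA₁CosetUnion n k reps gens
cosetUnion-isPSCA₁ {n} k reps gens closed covered y@(mkSeq ys len ys-unique)
  with (i , x) , (_ , c∈ , ys⊆x) , unique
         ← Coverage.allUniquelyCovered?-sound Fin._≟_ (allFin n) ∈-allFin k [] _ covered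
             ys len ys-unique (All.universal (λ _ ()) ys)
  with _ , g , g∈G , refl ← ∈-cosetCandidates⁻ reps (Subgroup.enumeration gens) c∈ =
  (i , x) , (g , enumeration⊆⟨⟩ g∈G , refl) , ys⊆x , unique′
  where
  open Subgroup gens

  unique′ : ∀ j z → InCosetUnion reps gens j z → Covers z y → i ≡ j × x ≡ z
  unique′ j z (g′ , g′∈⟨⟩ , refl) ys⊆z
    with jz≡ix ← unique (∈-cosetCandidates⁺ reps j (⟨⟩⊆closed (toWitness closed) g′∈⟨⟩))
                        ys⊆z =
    sym (,-injectiveˡ jz≡ix) , sym (,-injectiveʳ jz≡ix)

proposition4p11 : IsPSCA₁CosetUnion 4 3
    ( perm (1 ∷ 2 ∷ 3 ∷ 4 ∷ [])
    ∷ perm (1 ∷ 4 ∷ 3 ∷ 2 ∷ [])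
    ∷ perm (2 ∷ 4 ∷ 1 ∷ 3 ∷ [])
    ∷ [] )
    ( perm (3 ∷ 4 ∷ 1 ∷ 2 ∷ [])
    ∷ [] )
    ×
    IsPSCA₁CosetUnion 5 4
    ( perm (1 ∷ 2 ∷ 3 ∷ 4 ∷ 5 ∷ [])
    ∷ perm (1 ∷ 3 ∷ 2 ∷ 5 ∷ 4 ∷ [])
    ∷ perm (1 ∷ 4 ∷ 2 ∷ 5 ∷ 3 ∷ [])
    ∷ perm (1 ∷ 5 ∷ 2 ∷ 4 ∷ 3 ∷ [])
    ∷ perm (1 ∷ 5 ∷ 3 ∷ 4 ∷ 2 ∷ [])
    ∷ perm (5 ∷ 1 ∷ 4 ∷ 3 ∷ 2 ∷ [])
    ∷ [] )
    ( perm (3 ∷ 4 ∷ 1 ∷ 2 ∷ 5 ∷ [])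
    ∷ perm (4 ∷ 3 ∷ 2 ∷ 1 ∷ 5 ∷ [])
    ∷ [] )
    ×
    IsPSCA₁CosetUnion 6 5
    ( perm (1 ∷ 2 ∷ 3 ∷ 4 ∷ 5 ∷ 6 ∷ [])
    ∷ perm (1 ∷ 3 ∷ 2 ∷ 5 ∷ 4 ∷ 6 ∷ [])
    ∷ perm (1 ∷ 3 ∷ 2 ∷ 6 ∷ 4 ∷ 5 ∷ [])
    ∷ perm (1 ∷ 3 ∷ 5 ∷ 6 ∷ 4 ∷ 2 ∷ [])
    ∷ perm (1 ∷ 3 ∷ 6 ∷ 5 ∷ 2 ∷ 4 ∷ [])
    ∷ [] )
    ( perm (1 ∷ 2 ∷ 5 ∷ 6 ∷ 3 ∷ 4 ∷ [])
    ∷ perm (3 ∷ 4 ∷ 6 ∷ 5 ∷ 2 ∷ 1 ∷ [])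
    ∷ perm (3 ∷ 4 ∷ 5 ∷ 6 ∷ 1 ∷ 2 ∷ [])
    ∷ [] )
    ×
    IsPSCA₁CosetUnion 7 6
    ( perm (1 ∷ 2 ∷ 3 ∷ 4 ∷ 6 ∷ 5 ∷ 7 ∷ [])
    ∷ perm (1 ∷ 2 ∷ 3 ∷ 5 ∷ 4 ∷ 7 ∷ 6 ∷ [])
    ∷ perm (1 ∷ 2 ∷ 3 ∷ 7 ∷ 4 ∷ 5 ∷ 6 ∷ [])
    ∷ perm (1 ∷ 2 ∷ 7 ∷ 3 ∷ 5 ∷ 6 ∷ 4 ∷ [])
    ∷ perm (1 ∷ 3 ∷ 2 ∷ 4 ∷ 5 ∷ 7 ∷ 6 ∷ [])
    ∷ perm (1 ∷ 3 ∷ 2 ∷ 5 ∷ 4 ∷ 6 ∷ 7 ∷ [])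
    ∷ perm (1 ∷ 3 ∷ 2 ∷ 6 ∷ 4 ∷ 7 ∷ 5 ∷ [])
    ∷ perm (1 ∷ 3 ∷ 2 ∷ 6 ∷ 5 ∷ 7 ∷ 4 ∷ [])
    ∷ perm (1 ∷ 3 ∷ 4 ∷ 2 ∷ 7 ∷ 5 ∷ 6 ∷ [])
    ∷ perm (1 ∷ 3 ∷ 4 ∷ 5 ∷ 2 ∷ 6 ∷ 7 ∷ [])
    ∷ perm (1 ∷ 3 ∷ 5 ∷ 2 ∷ 7 ∷ 6 ∷ 4 ∷ [])
    ∷ perm (1 ∷ 3 ∷ 5 ∷ 6 ∷ 4 ∷ 2 ∷ 7 ∷ [])
    ∷ perm (1 ∷ 3 ∷ 5 ∷ 7 ∷ 2 ∷ 4 ∷ 6 ∷ [])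
    ∷ perm (3 ∷ 1 ∷ 2 ∷ 4 ∷ 7 ∷ 5 ∷ 6 ∷ [])
    ∷ perm (3 ∷ 1 ∷ 2 ∷ 5 ∷ 7 ∷ 4 ∷ 6 ∷ [])
    ∷ perm (3 ∷ 1 ∷ 2 ∷ 6 ∷ 7 ∷ 4 ∷ 5 ∷ [])
    ∷ perm (3 ∷ 1 ∷ 2 ∷ 7 ∷ 6 ∷ 5 ∷ 4 ∷ [])
    ∷ perm (3 ∷ 1 ∷ 4 ∷ 5 ∷ 6 ∷ 2 ∷ 7 ∷ [])
    ∷ perm (3 ∷ 1 ∷ 5 ∷ 4 ∷ 2 ∷ 6 ∷ 7 ∷ [])
    ∷ perm (3 ∷ 1 ∷ 5 ∷ 4 ∷ 7 ∷ 6 ∷ 2 ∷ [])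
    ∷ perm (3 ∷ 1 ∷ 5 ∷ 6 ∷ 7 ∷ 4 ∷ 2 ∷ [])
    ∷ perm (3 ∷ 4 ∷ 1 ∷ 2 ∷ 6 ∷ 5 ∷ 7 ∷ [])
    ∷ perm (3 ∷ 4 ∷ 1 ∷ 5 ∷ 2 ∷ 7 ∷ 6 ∷ [])
    ∷ perm (3 ∷ 4 ∷ 2 ∷ 1 ∷ 5 ∷ 6 ∷ 7 ∷ [])
    ∷ perm (3 ∷ 4 ∷ 2 ∷ 5 ∷ 1 ∷ 7 ∷ 6 ∷ [])
    ∷ perm (3 ∷ 4 ∷ 2 ∷ 6 ∷ 7 ∷ 1 ∷ 5 ∷ [])
    ∷ perm (3 ∷ 4 ∷ 2 ∷ 7 ∷ 6 ∷ 5 ∷ 1 ∷ [])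
    ∷ perm (3 ∷ 4 ∷ 5 ∷ 6 ∷ 1 ∷ 7 ∷ 2 ∷ [])
    ∷ perm (3 ∷ 4 ∷ 5 ∷ 7 ∷ 1 ∷ 2 ∷ 6 ∷ [])
    ∷ perm (3 ∷ 4 ∷ 5 ∷ 7 ∷ 6 ∷ 2 ∷ 1 ∷ [])
    ∷ [] )
    ( perm (7 ∷ 2 ∷ 3 ∷ 5 ∷ 4 ∷ 6 ∷ 1 ∷ [])
    ∷ perm (1 ∷ 7 ∷ 5 ∷ 6 ∷ 4 ∷ 3 ∷ 2 ∷ [])
    ∷ [] )
proposition4p11 =
  cosetUnion-isPSCA₁ 3 _ _ _ _ ,
  cosetUnion-isPSCA₁ 4 _ _ _ _ ,
  cosetUnion-isPSCA₁ 5 _ _ _ _ ,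
  cosetUnion-isPSCA₁ 6 _ _ _ _
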